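{- For any graph $G$ and any graph $H$ with root $v\in V(H)$, $$\max\{\chi_i(G),\chi_i(H),\Delta(G)+d_H(v)\}\le \chi_i(G\circ_v H)\le \max\{\chi_i(G),\chi_i(H),\Delta(G)+d_H(v)\}+1.$$
   Context: An injective $k$-coloring of a graph is a map $f:V\to\{1,\dots,k\}$ such that no vertex has two neighbors $u\neq w$ with $f(u)=f(w)$; $\chi_i$ denotes the least such $k$. For a graph $G$ with $V(G)=\{v_1,\ldots,v_n\}$ and a graph $H$ with root $v$, the rooted product $G\circ_v H$ has vertex set $V(G)\times V(H)$ and edge set $\bigcup_{i=1}^n\{(v_i,h)(v_i,h') : hh'\in E(H)\}\cup\{(v_i,v)(v_j,v): v_iv_j\in E(G)\}$ (i.e., a copy of $H$ is attached to each vertex $v_i$ of $G$ by identifying its root with $v_i$). $\Delta(G)$ is the maximum degree of $G$ and $d_H(v)$ the degree of $v$ in $H$. -}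

module Defs where

open import Data.Nat using (ℕ; zero; suc; _*_; _⊔_; _≤_)
open import Data.Fin using (Fin; remQuot)
open import Data.Fin.Properties using () renaming (_≟_ to _≟ᶠ_)
open import Data.Bool using (Bool; true; false; _∧_; _∨_)
open import Data.List using (List; length; filter; map; foldr)
open import Data.List using () renaming (allFin to allFinL)
open import Data.Product using (Σ; _×_; _,_)
open import Relation.Nullary.Decidable using (⌊_⌋)
open import Relation.Binary.PropositionalEquality using (_≡_)

record Graph : Set where
  constructor mkGraph
  field
    order : ℕ
    adj   : Fin order → Fin order → Bool
open Graph public

IsSimple : Graph → Set
IsSimple G = (∀ x y → adj G x y ≡ adj G y x) × (∀ x → adj G x x ≡ false)

deg : (G : Graph) → Fin (order G) → ℕ
deg G x = length (filter (λ y → adj G x y ≡? true) (allFinL (order G)))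
  where
  open import Data.Bool.Properties using () renaming (_≟_ to _≡?_)

-- Maximum degree (0 for the empty graph).
Δ : Graph → ℕ
Δ G = foldr _⊔_ 0 (map (deg G) (allFinL (order G)))

IsInjectiveColoring : (G : Graph) (k : ℕ) → (Fin (order G) → Fin k) → Set
IsInjectiveColoring G k f =
  ∀ x u w → adj G x u ≡ true → adj G x w ≡ true → f u ≡ f w → u ≡ w

InjColorable : Graph → ℕ → Set
InjColorable G k = Σ (Fin (order G) → Fin k) (IsInjectiveColoring G k)

IsInjChromaticNumber : Graph → ℕ → Set
IsInjChromaticNumber G k = InjColorable G k × (∀ m → InjColorable G m → k ≤ m)

_==ᶠ_ : ∀ {n} → Fin n → Fin n → Bool
a ==ᶠ b = ⌊ a ≟ᶠ b ⌋

-- Rooted product G ∘_v H on V(G) × V(H), the pair (i , h) encoded as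
-- combine i h : Fin (order G * order H) (inverse remQuot).
-- (i,h) ~ (j,h')  iff  (i = j and h h' ∈ E(H))  or  (h = h' = v and i j ∈ E(G)).
rootedProduct : (G H : Graph) → Fin (order H) → Graph
rootedProduct G H v = mkGraph (order G * order H) a
  where
  a : Fin (order G * order H) → Fin (order G * order H) → Bool
  a x y with remQuot (order H) x | remQuot (order H) y
  ... | i , h | j , h' =
    ((i ==ᶠ j) ∧ adj H h h') ∨ ((h ==ᶠ v) ∧ (h' ==ᶠ v) ∧ adj G i j)

-- Lower bound: an injective colouring of G ∘ᵥ H restricts to the copy of G
-- on the roots and to any copy of H, and the neighbourhood of a root (u , v)
-- consists of deg G u roots and deg H v vertices of the copy of H at u, all of
-- distinct colours.
-- Upper bound: with k the maximum and k + 1 colours, colour the root (i , v) by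
-- an injective colouring f of G and every other (i , h) by an injective
-- colouring g of H, relabelled injectively into the k colours different from
-- f i.  At most Δ G of these k colours occur on the G-neighbours of (i , v),
-- leaving at least deg H v of them for the colours g uses on the
-- H-neighbours of v, so the relabelling can be chosen to send those colours
-- to free ones.
module Submission where

open import Defs
open import Function using (_∘_; id; const)
open import Function.Definitions using (Injective)
open import Data.Nat using (ℕ; zero; suc; _+_; _*_; _⊔_; _≤_; z≤n; s≤s)
open import Data.Nat.Properties hiding (_≟_; suc-injective)
open import Data.Fin using (Fin; zero; suc; punchIn; splitAt; join; combine; remQuot; quotRem; inject≤; fromℕ<)
open import Data.Fin.Properties
  using (suc-injective; punchIn-injective; punchInᵢ≢i; remQuot-combine; combine-remQuot;
         combine-injective; join-splitAt; inject≤-injective; all?; ¬∀⟶∃¬)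
  renaming (_≟_ to _≟ᶠ_)
open import Data.Bool using (Bool; true; false; _∧_; _∨_; not)
open import Data.Bool.Properties using (∨-zeroʳ; ∧-identityʳ; ∧-zeroʳ; ¬-not; not-injective) renaming (_≟_ to _≟ᵇ_)
open import Data.List using (length; filter; map; tabulate; allFin)
open import Data.List.Properties using (foldr-forcesᵇ; foldr-preservesᵇ)
import Data.List.Relation.Unary.All as All
open import Data.List.Relation.Unary.All.Properties using (map⁺; map⁻; tabulate⁺)
open import Data.List.Membership.Propositional.Properties using (∈-allFin)
open import Data.Product using (∃; _×_; _,_; proj₁; proj₂; uncurry; swap)
open import Data.Sum using (_⊎_; inj₁; inj₂; [_,_]′; map₁)
open import Relation.Nullary using (yes; no; contradiction)
open import Relation.Binary.PropositionalEquality
open import Algebra.Properties.CommutativeSemigroup +-commutativeSemigroup using (interchange; x∙yz≈y∙xz)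

private
  variable
    m n : ℕ

bit : Bool → ℕ
bit false = 0
bit true  = 1

bit≤1 : ∀ b → bit b ≤ 1
bit≤1 false = z≤n
bit≤1 true  = ≤-refl

∨≡true : ∀ a b → a ∨ b ≡ true → a ≡ true ⊎ b ≡ true
∨≡true true  b _ = inj₁ refl
∨≡true false b e = inj₂ e

∧≡true : ∀ a b → a ∧ b ≡ true → a ≡ true × b ≡ true
∧≡true true true _ = refl , refl

==ᶠ-refl : (a : Fin n) → (a ==ᶠ a) ≡ true
==ᶠ-refl a with a ≟ᶠ a
... | yes _  = refl
... | no a≢a = contradiction refl a≢a

==ᶠ⇒≡ : (a b : Fin n) → (a ==ᶠ b) ≡ true → a ≡ b
==ᶠ⇒≡ a b e with a ≟ᶠ b
... | yes a≡b = a≡b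

≢⇒==ᶠ-false : (a b : Fin n) → a ≢ b → (a ==ᶠ b) ≡ false
≢⇒==ᶠ-false a b a≢b with a ≟ᶠ b
... | yes a≡b = contradiction a≡b a≢b
... | no _    = refl

count : (Fin n → Bool) → ℕ
count {zero}  P = 0
count {suc n} P = bit (P zero) + count (P ∘ suc)

count-cong : {P Q : Fin n → Bool} → (∀ x → P x ≡ Q x) → count P ≡ count Q
count-cong {zero}  _   = refl
count-cong {suc n} P≗Q = cong₂ _+_ (cong bit (P≗Q zero)) (count-cong (P≗Q ∘ suc))

count≤n : (P : Fin n → Bool) → count P ≤ n
count≤n {zero}  P = z≤n
count≤n {suc n} P = +-mono-≤ (bit≤1 (P zero)) (count≤n (P ∘ suc))

count-true : {P : Fin n → Bool} → (∀ x → P x ≡ true) → count P ≡ n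
count-true {zero}  _  = refl
count-true {suc n} Pt rewrite Pt zero = cong suc (count-true (Pt ∘ suc))

count-false : {P : Fin n → Bool} → (∀ x → P x ≡ false) → count P ≡ 0
count-false {zero}  _  = refl
count-false {suc n} Pf rewrite Pf zero = count-false (Pf ∘ suc)

count-not : (P : Fin n → Bool) → count (not ∘ P) + count P ≡ n
count-not {zero}  P = refl
count-not {suc n} P with P zero
... | true  = trans (+-suc _ _) (cong suc (count-not (P ∘ suc)))
... | false = cong suc (count-not (P ∘ suc))

count-punchIn : (c : Fin (suc n)) (P : Fin (suc n) → Bool) →
                count P ≡ bit (P c) + count (P ∘ punchIn c)
count-punchIn         zero    P = refl
count-punchIn {suc n} (suc c) P = begin
  bit (P zero) + count (P ∘ suc)                                     ≡⟨ cong (bit (P zero) +_) (count-punchIn c (P ∘ suc)) ⟩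
  bit (P zero) + (bit (P (suc c)) + count (P ∘ suc ∘ punchIn c))     ≡⟨ x∙yz≈y∙xz (bit (P zero)) (bit (P (suc c))) _ ⟩
  bit (P (suc c)) + (bit (P zero) + count (P ∘ suc ∘ punchIn c))     ∎
  where open ≡-Reasoning

count-true-punchIn : (c : Fin (suc n)) (P : Fin (suc n) → Bool) → P c ≡ true →
                     count P ≡ suc (count (P ∘ punchIn c))
count-true-punchIn c P Pc = trans (count-punchIn c P) (cong (λ b → bit b + count (P ∘ punchIn c)) Pc)

count-false-punchIn : (c : Fin (suc n)) (P : Fin (suc n) → Bool) → P c ≡ false →
                      count P ≡ count (P ∘ punchIn c)
count-false-punchIn c P Pc = trans (count-punchIn c P) (cong (λ b → bit b + count (P ∘ punchIn c)) Pc)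

count-splitAt : (P : Fin m → Bool) (Q : Fin n → Bool) →
                count ([ P , Q ]′ ∘ splitAt m) ≡ count P + count Q
count-splitAt {zero}  P Q = refl
count-splitAt {suc m} P Q = trans
  (cong (bit (P zero) +_) (trans (count-cong splitAt-suc) (count-splitAt (P ∘ suc) Q)))
  (sym (+-assoc (bit (P zero)) (count (P ∘ suc)) (count Q)))
  where
  splitAt-suc : ∀ z → [ P , Q ]′ (map₁ suc (splitAt m z)) ≡ [ P ∘ suc , Q ]′ (splitAt m z)
  splitAt-suc z with splitAt m z
  ... | inj₁ _ = refl
  ... | inj₂ _ = refl

count-∨ : (P Q : Fin n → Bool) → count (λ x → P x ∨ Q x) ≤ count P + count Q
count-∨ {zero}  P Q = z≤n
count-∨ {suc n} P Q = begin
  bit (P zero ∨ Q zero) + count (λ x → P (suc x) ∨ Q (suc x))        ≤⟨ +-mono-≤ (bit-∨ (P zero) (Q zero)) (count-∨ (P ∘ suc) (Q ∘ suc)) ⟩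
  (bit (P zero) + bit (Q zero)) + (count (P ∘ suc) + count (Q ∘ suc)) ≡⟨ interchange (bit (P zero)) (bit (Q zero)) (count (P ∘ suc)) (count (Q ∘ suc)) ⟩
  count P + count Q                                                   ∎
  where
  open ≤-Reasoning
  bit-∨ : ∀ a b → bit (a ∨ b) ≤ bit a + bit b
  bit-∨ true  b = s≤s z≤n
  bit-∨ false b = ≤-refl

count-witness : (P : Fin n → Bool) → 1 ≤ count P → ∃ λ x → P x ≡ true
count-witness {suc n} P p with P zero in e
... | true  = zero , e
... | false = let x , Px = count-witness (P ∘ suc) p in suc x , Px

count-≡ : (c : Fin n) → count (c ==ᶠ_) ≡ 1
count-≡ {suc n} c = begin
  count (c ==ᶠ_)                                         ≡⟨ count-true-punchIn c (c ==ᶠ_) (==ᶠ-refl c) ⟩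
  suc (count (λ x → c ==ᶠ punchIn c x))                  ≡⟨ cong suc (count-false (λ x → ≢⇒==ᶠ-false c _ (punchInᵢ≢i c x ∘ sym))) ⟩
  1                                                      ∎
  where open ≡-Reasoning

image : (Fin m → Bool) → (Fin m → Fin n) → Fin n → Bool
image {zero}  A g y = false
image {suc m} A g y = (A zero ∧ (g zero ==ᶠ y)) ∨ image (A ∘ suc) (g ∘ suc) y

image-intro : (A : Fin m → Bool) (g : Fin m → Fin n) (x : Fin m) →
              A x ≡ true → image A g (g x) ≡ true
image-intro A g zero    Ax rewrite Ax | ==ᶠ-refl (g zero) = refl
image-intro A g (suc x) Ax rewrite image-intro (A ∘ suc) (g ∘ suc) x Ax = ∨-zeroʳ _

count-image : (A : Fin m → Bool) (g : Fin m → Fin n) → count (image A g) ≤ count A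
count-image {zero}  {n} A g = ≤-reflexive (count-false {n} (λ _ → refl))
count-image {suc m} {n} A g =
  ≤-trans (count-∨ (λ y → A zero ∧ (g zero ==ᶠ y)) _)
          (+-mono-≤ (first (A zero)) (count-image (A ∘ suc) (g ∘ suc)))
  where
  first : ∀ a → count (λ y → a ∧ (g zero ==ᶠ y)) ≤ bit a
  first true  = ≤-reflexive (count-≡ (g zero))
  first false = ≤-reflexive (count-false {n} (λ _ → refl))

count-without : (c : Fin n) (B : Fin n → Bool) → B c ≡ true →
                count B ≡ suc (count (λ z → B z ∧ not (c ==ᶠ z)))
count-without {suc n} c B Bc = begin
  count B                              ≡⟨ count-true-punchIn c B Bc ⟩
  suc (count (B ∘ punchIn c))          ≡⟨ cong suc (count-cong removed) ⟩
  suc (count (B′ ∘ punchIn c))         ≡⟨ cong suc (count-false-punchIn c B′ c∉B′) ⟨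
  suc (count B′)                       ∎
  where
  open ≡-Reasoning
  B′ : Fin (suc n) → Bool
  B′ z = B z ∧ not (c ==ᶠ z)
  c∉B′ : B′ c ≡ false
  c∉B′ rewrite ==ᶠ-refl c = ∧-zeroʳ (B c)
  removed : ∀ x → B (punchIn c x) ≡ B′ (punchIn c x)
  removed x rewrite ≢⇒==ᶠ-false c _ (punchInᵢ≢i c x ∘ sym) = sym (∧-identityʳ _)

InjectiveOn : (Fin m → Bool) → (Fin m → Fin n) → Set
InjectiveOn A g = ∀ x y → A x ≡ true → A y ≡ true → g x ≡ g y → x ≡ y

injectiveOn-suc : {A : Fin (suc m) → Bool} {g : Fin (suc m) → Fin n} →
                  InjectiveOn A g → InjectiveOn (A ∘ suc) (g ∘ suc)
injectiveOn-suc g-inj x y Ax Ay = suc-injective ∘ g-inj (suc x) (suc y) Ax Ay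

count-≤-injection : (A : Fin m → Bool) (B : Fin n → Bool) (g : Fin m → Fin n) →
                    (∀ x → A x ≡ true → B (g x) ≡ true) → InjectiveOn A g →
                    count A ≤ count B
count-≤-injection {zero}  A B g A⇒B g-inj = z≤n
count-≤-injection {suc m} A B g A⇒B g-inj with A zero in e
... | false = count-≤-injection (A ∘ suc) B (g ∘ suc) (A⇒B ∘ suc) (injectiveOn-suc g-inj)
... | true  = begin
  suc (count (A ∘ suc))   ≤⟨ s≤s (count-≤-injection (A ∘ suc) B′ (g ∘ suc) A⇒B′ (injectiveOn-suc g-inj)) ⟩
  suc (count B′)          ≡⟨ count-without (g zero) B (A⇒B zero e) ⟨
  count B                 ∎
  where
  open ≤-Reasoning
  B′ : Fin _ → Bool
  B′ z = B z ∧ not (g zero ==ᶠ z)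

  g0≢g∘suc : ∀ x → A (suc x) ≡ true → g zero ≢ g (suc x)
  g0≢g∘suc x Ax eq with () ← g-inj zero (suc x) e Ax eq

  A⇒B′ : ∀ x → A (suc x) ≡ true → B′ (g (suc x)) ≡ true
  A⇒B′ x Ax rewrite A⇒B (suc x) Ax | ≢⇒==ᶠ-false (g zero) (g (suc x)) (g0≢g∘suc x Ax) = refl

count-injective : (A : Fin m → Bool) (g : Fin m → Fin n) → InjectiveOn A g → count A ≤ n
count-injective A g g-inj =
  ≤-trans (count-≤-injection A (const true) g (λ _ _ → refl) g-inj) (≤-reflexive (count-true (λ _ → refl)))

Embeds : (Fin m → Bool) → (Fin n → Bool) → Set
Embeds P Q = ∃ λ ρ → Injective _≡_ _≡_ ρ × (∀ x → P x ≡ true → Q (ρ x) ≡ true)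

embeds-cons : (P : Fin (suc m) → Bool) (Q : Fin (suc n) → Bool) (y : Fin (suc n)) →
              (P zero ≡ true → Q y ≡ true) → Embeds (P ∘ suc) (Q ∘ punchIn y) → Embeds P Q
embeds-cons P Q y P0⇒Qy (ρ , ρ-inj , ρ-pres) = ρ′ , ρ′-inj , ρ′-pres
  where
  ρ′ : Fin (suc _) → Fin (suc _)
  ρ′ zero    = y
  ρ′ (suc x) = punchIn y (ρ x)

  ρ′-inj : Injective _≡_ _≡_ ρ′
  ρ′-inj {zero}  {zero}  _  = refl
  ρ′-inj {zero}  {suc z} eq = contradiction (sym eq) (punchInᵢ≢i y (ρ z))
  ρ′-inj {suc x} {zero}  eq = contradiction eq (punchInᵢ≢i y (ρ x))
  ρ′-inj {suc x} {suc z} eq = cong suc (ρ-inj (punchIn-injective y (ρ x) (ρ z) eq))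

  ρ′-pres : ∀ x → P x ≡ true → Q (ρ′ x) ≡ true
  ρ′-pres zero    = P0⇒Qy
  ρ′-pres (suc x) = ρ-pres x

-- Where to send zero: a point of Q if zero ∈ P, a point outside Q if zero ∉ P
-- and one exists, and otherwise any point (then Q is everything).
embedding-pivot : m ≤ n → (P : Fin (suc m) → Bool) (Q : Fin (suc n) → Bool) → count P ≤ count Q →
                  ∃ λ y → (P zero ≡ true → Q y ≡ true) × count (P ∘ suc) ≤ count (Q ∘ punchIn y)
embedding-pivot m≤n P Q P≤Q with P zero in e
... | true =
  let y , Qy = count-witness Q (≤-trans (s≤s z≤n) P≤Q)
  in  y , const Qy , ≤-pred (≤-trans P≤Q (≤-reflexive (count-true-punchIn y Q Qy)))
... | false with all? (λ y → Q y ≟ᵇ true)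
...   | yes Q-all = zero , (λ ()) ,
  ≤-trans (count≤n (P ∘ suc)) (≤-trans m≤n (≤-reflexive (sym (count-true (Q-all ∘ suc)))))
...   | no ¬Q-all =
  let y , ¬Qy = ¬∀⟶∃¬ _ _ (λ y → Q y ≟ᵇ true) ¬Q-all
  in  y , (λ ()) , ≤-trans P≤Q (≤-reflexive (count-false-punchIn y Q (¬-not ¬Qy)))

embed : m ≤ n → (P : Fin m → Bool) (Q : Fin n → Bool) → count P ≤ count Q → Embeds P Q
embed {zero}                  _         P Q _   = (λ ()) , (λ { {()} }) , (λ ())
embed {suc m} {suc n} (s≤s m≤n) P Q P≤Q =
  let y , P0⇒Qy , P′≤Q′ = embedding-pivot m≤n P Q P≤Q
  in  embeds-cons P Q y P0⇒Qy (embed m≤n (P ∘ suc) (Q ∘ punchIn y) P′≤Q′)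

length-filter-tabulate : {A : Set} (f : Fin n → A) (Q : A → Bool) →
                         length (filter (λ a → Q a ≟ᵇ true) (tabulate f)) ≡ count (Q ∘ f)
length-filter-tabulate {zero}  f Q = refl
length-filter-tabulate {suc n} f Q with Q (f zero)
... | true  = cong suc (length-filter-tabulate (f ∘ suc) Q)
... | false = length-filter-tabulate (f ∘ suc) Q

deg≡count : (G : Graph) (x : Fin (order G)) → deg G x ≡ count (adj G x)
deg≡count G x = length-filter-tabulate id (adj G x)

deg≤Δ : (G : Graph) (x : Fin (order G)) → deg G x ≤ Δ G
deg≤Δ G x = All.lookup (map⁻ degs≤Δ) (∈-allFin x)
  where
  degs≤Δ : All.All (_≤ Δ G) (map (deg G) (allFin (order G)))
  degs≤Δ = foldr-forcesᵇ (λ a b a⊔b≤ → m⊔n≤o⇒m≤o a b a⊔b≤ , m⊔n≤o⇒n≤o a b a⊔b≤) 0 _ ≤-refl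

Δ-attained : (G : Graph) → Fin (order G) → ∃ λ u → Δ G ≤ deg G u
Δ-attained G z = foldr-preservesᵇ {P = Attained} ⊔-attained (z , z≤n) (map⁺ (tabulate⁺ (λ u → u , ≤-refl)))
  where
  Attained : ℕ → Set
  Attained d = ∃ λ u → d ≤ deg G u
  ⊔-attained : ∀ {a b} → Attained a → Attained b → Attained (a ⊔ b)
  ⊔-attained {a} {b} (u , a≤) (w , b≤) with ≤-total a b
  ... | inj₁ a≤b = w , ⊔-lub (≤-trans a≤b b≤) b≤
  ... | inj₂ b≤a = u , ⊔-lub a≤ (≤-trans b≤a a≤)

module RootedProduct (G H : Graph) (v : Fin (order H)) where

  G∘H : Graph
  G∘H = rootedProduct G H v

  -- The adjacency of G∘H reduces to quotRem, since remQuot unfolds to swap ∘ quotRem.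
  quotRem-combine : ∀ i h → quotRem {order G} (order H) (combine i h) ≡ (h , i)
  quotRem-combine i h = cong swap (remQuot-combine i h)

  adj-combine : ∀ i h j h′ → adj G∘H (combine i h) (combine j h′) ≡
                ((i ==ᶠ j) ∧ adj H h h′) ∨ ((h ==ᶠ v) ∧ (h′ ==ᶠ v) ∧ adj G i j)
  adj-combine i h j h′ rewrite quotRem-combine i h | quotRem-combine j h′ = refl

  _~_ : Fin (order G) × Fin (order H) → Fin (order G) × Fin (order H) → Set
  (i , h) ~ (j , h′) = (i ≡ j × adj H h h′ ≡ true) ⊎ (h ≡ v × h′ ≡ v × adj G i j ≡ true)

  coords : Fin (order G * order H) → Fin (order G) × Fin (order H)
  coords = remQuot (order H)

  coords-injective : ∀ {x y} → coords x ≡ coords y → x ≡ y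
  coords-injective {x} {y} eq = begin
    x                          ≡⟨ combine-remQuot {order G} (order H) x ⟨
    uncurry combine (coords x) ≡⟨ cong (uncurry combine) eq ⟩
    uncurry combine (coords y) ≡⟨ combine-remQuot {order G} (order H) y ⟩
    y                          ∎
    where open ≡-Reasoning

  adj⇒~ : ∀ x y → adj G∘H x y ≡ true → coords x ~ coords y
  adj⇒~ x y = decode (coords x) (coords y)
    where
    decode : ∀ p q → ((proj₁ p ==ᶠ proj₁ q) ∧ adj H (proj₂ p) (proj₂ q)) ∨
                     ((proj₂ p ==ᶠ v) ∧ (proj₂ q ==ᶠ v) ∧ adj G (proj₁ p) (proj₁ q)) ≡ true → p ~ q
    decode (i , h) (j , h′) e with ∨≡true _ _ e
    ... | inj₁ copy = let i=j , hh′ = ∧≡true _ _ copy in inj₁ (==ᶠ⇒≡ i j i=j , hh′)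
    ... | inj₂ root = let h=v , rest = ∧≡true _ _ root ; h′=v , ij = ∧≡true _ _ rest in
                      inj₂ (==ᶠ⇒≡ h v h=v , ==ᶠ⇒≡ h′ v h′=v , ij)

  copy-adj : ∀ i {h h′} → adj H h h′ ≡ true → adj G∘H (combine i h) (combine i h′) ≡ true
  copy-adj i {h} {h′} e rewrite adj-combine i h i h′ | ==ᶠ-refl i | e = refl

  root-adj : ∀ {i j} → adj G i j ≡ true → adj G∘H (combine i v) (combine j v) ≡ true
  root-adj {i} {j} e rewrite adj-combine i v j v | ==ᶠ-refl v | e = ∨-zeroʳ _

module LowerBound (G H : Graph) (v : Fin (order H)) (H-loopless : ∀ h → adj H h h ≡ false)
                  {c : ℕ} (col : Fin (order G * order H) → Fin c)
                  (col-inj : IsInjectiveColoring (rootedProduct G H v) c col) where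
  open RootedProduct G H v

  colourable-G : InjColorable G c
  colourable-G = (λ i → col (combine i v)) , λ x u w xu xw eq →
    proj₁ (combine-injective u v w v (col-inj (combine x v) _ _ (root-adj xu) (root-adj xw) eq))

  colourable-H : Fin (order G) → InjColorable H c
  colourable-H i = (λ h → col (combine i h)) , λ x u w xu xw eq →
    proj₂ (combine-injective i u i w (col-inj (combine i x) _ _ (copy-adj i xu) (copy-adj i xw) eq))

  module _ (u : Fin (order G)) where

    IsNeighbour : Fin (order G) ⊎ Fin (order H) → Bool
    IsNeighbour = [ adj G u , adj H v ]′

    neighbour : Fin (order G) ⊎ Fin (order H) → Fin (order G * order H)
    neighbour = [ (λ w → combine w v) , combine u ]′

    neighbour-adj : ∀ s → IsNeighbour s ≡ true → adj G∘H (combine u v) (neighbour s) ≡ true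
    neighbour-adj (inj₁ w) = root-adj
    neighbour-adj (inj₂ h) = copy-adj u

    neighbour-injective : InjectiveOn (IsNeighbour ∘ splitAt (order G)) (neighbour ∘ splitAt (order G))
    neighbour-injective x y Nx Ny eq = begin
      x                                              ≡⟨ join-splitAt (order G) (order H) x ⟨
      join (order G) (order H) (splitAt (order G) x) ≡⟨ cong (join (order G) (order H)) (on-sum (splitAt (order G) x) (splitAt (order G) y) Nx Ny eq) ⟩
      join (order G) (order H) (splitAt (order G) y) ≡⟨ join-splitAt (order G) (order H) y ⟩
      y                                              ∎
      where
      open ≡-Reasoning
      on-sum : ∀ s t → IsNeighbour s ≡ true → IsNeighbour t ≡ true → neighbour s ≡ neighbour t → s ≡ t
      on-sum (inj₁ w) (inj₁ w′) _ _ eq = cong inj₁ (proj₁ (combine-injective w v w′ v eq))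
      on-sum (inj₂ h) (inj₂ h′) _ _ eq = cong inj₂ (proj₂ (combine-injective u h u h′ eq))
      on-sum (inj₁ w) (inj₂ h)  _ vh eq with refl , refl ← combine-injective w v u h eq
        = contradiction (trans (sym vh) (H-loopless v)) λ ()
      on-sum (inj₂ h) (inj₁ w) vh _ eq with refl , refl ← combine-injective u h w v eq
        = contradiction (trans (sym vh) (H-loopless v)) λ ()

    deg+deg≤colours : deg G u + deg H v ≤ c
    deg+deg≤colours = begin
      deg G u + deg H v                               ≡⟨ cong₂ _+_ (deg≡count G u) (deg≡count H v) ⟩
      count (adj G u) + count (adj H v)               ≡⟨ count-splitAt (adj G u) (adj H v) ⟨
      count (IsNeighbour ∘ splitAt (order G))         ≤⟨ count-injective _ (col ∘ neighbour ∘ splitAt (order G)) col∘neighbour-inj ⟩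
      c                                               ∎
      where
      open ≤-Reasoning
      col∘neighbour-inj : InjectiveOn (IsNeighbour ∘ splitAt (order G)) (col ∘ neighbour ∘ splitAt (order G))
      col∘neighbour-inj x y Nx Ny = neighbour-injective x y Nx Ny ∘
        col-inj (combine u v) _ _ (neighbour-adj (splitAt (order G) x) Nx) (neighbour-adj (splitAt (order G) y) Ny)

  Δ+deg≤colours : Fin (order G) → Δ G + deg H v ≤ c
  Δ+deg≤colours z =
    let u , Δ≤deg = Δ-attained G z in ≤-trans (+-monoˡ-≤ (deg H v) Δ≤deg) (deg+deg≤colours u)

module UpperBound (G H : Graph) (v : Fin (order H)) (H-loopless : ∀ h → adj H h h ≡ false)
                  {a b k : ℕ} (f : Fin (order G) → Fin a) (f-inj : IsInjectiveColoring G a f)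
                  (g : Fin (order H) → Fin b) (g-inj : IsInjectiveColoring H b g)
                  (a≤k : a ≤ k) (b≤k : b ≤ k) (Δ+deg≤k : Δ G + deg H v ≤ k) where
  open RootedProduct G H v

  rootColour : Fin (order G) → Fin (suc k)
  rootColour i = inject≤ (f i) (m≤n⇒m≤1+n a≤k)

  blocked : Fin (order G) → Fin (suc k) → Bool
  blocked i = image (adj G i) rootColour

  free : Fin (order G) → Fin k → Bool
  free i y = not (blocked i (punchIn (rootColour i) y))

  needed : Fin b → Bool
  needed = image (adj H v) g

  needed≤free : ∀ i → count needed ≤ count (free i)
  needed≤free i = +-cancelˡ-≤ (Δ G) _ _ (begin
    Δ G + count needed                               ≤⟨ +-monoʳ-≤ (Δ G) needed≤deg ⟩
    Δ G + deg H v                                    ≤⟨ Δ+deg≤k ⟩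
    k                                                ≤⟨ k≤free+blocked ⟩
    count (free i) + count (blocked i)               ≤⟨ +-monoʳ-≤ (count (free i)) blocked≤Δ ⟩
    count (free i) + Δ G                             ≡⟨ +-comm (count (free i)) (Δ G) ⟩
    Δ G + count (free i)                             ∎)
    where
    open ≤-Reasoning
    needed≤deg : count needed ≤ deg H v
    needed≤deg = ≤-trans (count-image (adj H v) g) (≤-reflexive (sym (deg≡count H v)))
    blocked≤Δ : count (blocked i) ≤ Δ G
    blocked≤Δ = ≤-trans (count-image (adj G i) rootColour) (≤-trans (≤-reflexive (sym (deg≡count G i))) (deg≤Δ G i))
    k≤free+blocked : k ≤ count (free i) + count (blocked i)
    k≤free+blocked = ≤-pred (begin
      suc k                                                ≡⟨ count-not (blocked i) ⟨
      count (not ∘ blocked i) + count (blocked i)          ≡⟨ cong (_+ count (blocked i)) (count-punchIn (rootColour i) (not ∘ blocked i)) ⟩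
      (bit (not (blocked i (rootColour i))) + count (free i)) + count (blocked i)
        ≤⟨ +-monoˡ-≤ (count (blocked i)) (+-monoˡ-≤ (count (free i)) (bit≤1 (not (blocked i (rootColour i))))) ⟩
      suc (count (free i) + count (blocked i))             ∎)

  relabel : ∀ i → Embeds needed (free i)
  relabel i = embed b≤k needed (free i) (needed≤free i)

  colour : Fin (order G) → Fin (order H) → Fin (suc k)
  colour i h with h ≟ᶠ v
  ... | yes _ = rootColour i
  ... | no  _ = punchIn (rootColour i) (proj₁ (relabel i) (g h))

  copy-distinct : ∀ i h {h₁ h₂} → adj H h h₁ ≡ true → adj H h h₂ ≡ true →
                  colour i h₁ ≡ colour i h₂ → h₁ ≡ h₂
  copy-distinct i h {h₁} {h₂} hh₁ hh₂ eq with h₁ ≟ᶠ v | h₂ ≟ᶠ v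
  ... | yes refl | yes refl = refl
  ... | yes _    | no  _    = contradiction (sym eq) (punchInᵢ≢i (rootColour i) _)
  ... | no  _    | yes _    = contradiction eq (punchInᵢ≢i (rootColour i) _)
  ... | no  _    | no  _    =
    g-inj h h₁ h₂ hh₁ hh₂ (proj₁ (proj₂ (relabel i)) (punchIn-injective (rootColour i) _ _ eq))

  copy-root-distinct : ∀ i {h j} → adj H v h ≡ true → adj G i j ≡ true → colour i h ≢ colour j v
  copy-root-distinct i {h} {j} vh ij eq with h ≟ᶠ v | v ≟ᶠ v
  ... | yes refl | _ = contradiction (trans (sym vh) (H-loopless v)) λ ()
  ... | no _ | no v≢v = contradiction refl v≢v
  ... | no _ | yes _ = contradiction (trans (sym blocked-colour) not-blocked) λ ()
    where
    blocked-colour : blocked i (punchIn (rootColour i) (proj₁ (relabel i) (g h))) ≡ true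
    blocked-colour = trans (cong (blocked i) eq) (image-intro (adj G i) rootColour j ij)
    not-blocked : blocked i (punchIn (rootColour i) (proj₁ (relabel i) (g h))) ≡ false
    not-blocked = not-injective (proj₂ (proj₂ (relabel i)) (g h) (image-intro (adj H v) g h vh))

  root-distinct : ∀ i {j₁ j₂} → adj G i j₁ ≡ true → adj G i j₂ ≡ true →
                  colour j₁ v ≡ colour j₂ v → j₁ ≡ j₂
  root-distinct i {j₁} {j₂} ij₁ ij₂ eq with v ≟ᶠ v
  ... | yes _   = f-inj i j₁ j₂ ij₁ ij₂ (inject≤-injective _ _ (f j₁) (f j₂) eq)
  ... | no v≢v  = contradiction refl v≢v

  neighbours-distinct : ∀ p q r → p ~ q → p ~ r → uncurry colour q ≡ uncurry colour r → q ≡ r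
  neighbours-distinct (i , h) (.i , h₁) (.i , h₂) (inj₁ (refl , hh₁)) (inj₁ (refl , hh₂)) eq =
    cong (i ,_) (copy-distinct i h hh₁ hh₂ eq)
  neighbours-distinct (i , h) (.i , h₁) (j , .v) (inj₁ (refl , vh₁)) (inj₂ (refl , refl , ij)) eq =
    contradiction eq (copy-root-distinct i vh₁ ij)
  neighbours-distinct (i , h) (j , .v) (.i , h₂) (inj₂ (refl , refl , ij)) (inj₁ (refl , vh₂)) eq =
    contradiction (sym eq) (copy-root-distinct i vh₂ ij)
  neighbours-distinct (i , h) (j₁ , .v) (j₂ , .v) (inj₂ (refl , refl , ij₁)) (inj₂ (_ , refl , ij₂)) eq =
    cong (_, v) (root-distinct i ij₁ ij₂ eq)

  colourᴾ : Fin (order G * order H) → Fin (suc k)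
  colourᴾ = uncurry colour ∘ coords

  colourᴾ-injective : IsInjectiveColoring G∘H (suc k) colourᴾ
  colourᴾ-injective x y z xy xz =
    coords-injective ∘ neighbours-distinct (coords x) (coords y) (coords z) (adj⇒~ x y xy) (adj⇒~ x z xz)

corollary4p7 : (G H : Graph) (v : Fin (order H)) →
    IsSimple G → IsSimple H → 1 ≤ order G →
    (a b c : ℕ) →
    IsInjChromaticNumber G a → IsInjChromaticNumber H b →
    IsInjChromaticNumber (rootedProduct G H v) c →
    (a ⊔ b ⊔ (Δ G + deg H v) ≤ c) × (c ≤ suc (a ⊔ b ⊔ (Δ G + deg H v)))
corollary4p7 G H v _ (_ , H-loopless) 1≤|G| a b c
             ((f , f-inj) , a-least) ((g , g-inj) , b-least) ((col , col-inj) , c-least) =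
  ⊔-lub (⊔-lub (a-least c L.colourable-G) (b-least c (L.colourable-H z))) (L.Δ+deg≤colours z) ,
  c-least (suc k) (U.colourᴾ , U.colourᴾ-injective)
  where
  z : Fin (order G)
  z = fromℕ< 1≤|G|
  k : ℕ
  k = a ⊔ b ⊔ (Δ G + deg H v)
  module L = LowerBound G H v H-loopless col col-inj
  module U = UpperBound G H v H-loopless f f-inj g g-inj
               (≤-trans (m≤m⊔n a b) (m≤m⊔n _ _)) (≤-trans (m≤n⊔m a b) (m≤m⊔n _ _)) (m≤n⊔m (a ⊔ b) _)
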